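{- Let $R$ be a commutative ring with unity such that $\mathcal{M}^i\neq\mathcal{M}^{i+1}$ for every maximal ideal $\mathcal{M}$ and all $i\geq 0$. Suppose $$\mathcal{I}=\mathcal{M}_1^{t_1}\mathcal{M}_2^{t_2}\cdots\mathcal{M}_k^{t_k}=\mathcal{N}_1^{s_1}\mathcal{N}_2^{s_2}\cdots\mathcal{N}_r^{s_r},$$ where $\mathcal{M}_1,\dots,\mathcal{M}_k$ are pairwise distinct maximal ideals, $\mathcal{N}_1,\dots,\mathcal{N}_r$ are pairwise distinct maximal ideals, and all $t_i,s_j$ are positive integers. Then $r=k$, $\{\mathcal{M}_1,\dots,\mathcal{M}_k\}=\{\mathcal{N}_1,\dots,\mathcal{N}_r\}$, and after a suitable permutation of the $\mathcal{N}_j$ we have $t_i=s_i$ for all $1\le i\le k$. -}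

module Defs where

open import Level using (Level; _⊔_; suc)
open import Algebra.Bundles using (CommutativeRing)
open import Data.Nat using (ℕ; zero) renaming (suc to sucℕ)
open import Data.Fin using (Fin) renaming (zero to fzero; suc to fsuc)
open import Data.Product using (_×_)
open import Data.Sum using (_⊎_)
open import Relation.Nullary using (¬_)
open import Relation.Unary using (Pred)

module IdealTheory {c ℓ : Level} (R : CommutativeRing c ℓ) where
  open CommutativeRing R

  Sub : Set (suc (c ⊔ ℓ))
  Sub = Pred Carrier (c ⊔ ℓ)

  record IsIdeal (I : Sub) : Set (c ⊔ ℓ) where
    field
      resp  : ∀ {x y} → x ≈ y → I x → I y
      zero∈ : I 0#
      +-closed : ∀ {x y} → I x → I y → I (x + y)
      *-closed : ∀ (r : Carrier) {x} → I x → I (r * x)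

  _⊆I_ : Sub → Sub → Set (c ⊔ ℓ)
  I ⊆I J = ∀ x → I x → J x

  _≐_ : Sub → Sub → Set (c ⊔ ℓ)
  I ≐ J = (I ⊆I J) × (J ⊆I I)

  whole : Sub
  whole _ = Level.Lift (c ⊔ ℓ) Data.Unit.⊤
    where import Data.Unit

  data _·_ (I J : Sub) : Sub where
    gen  : ∀ {x a b} → I a → J b → x ≈ a * b → (I · J) x
    nil  : ∀ {x} → x ≈ 0# → (I · J) x
    plus : ∀ {x y z} → (I · J) y → (I · J) z → x ≈ y + z → (I · J) x

  _^_ : Sub → ℕ → Sub
  I ^ zero = whole
  I ^ sucℕ n = (I ^ n) · I

  record IsMaximal (M : Sub) : Set (suc (c ⊔ ℓ)) where
    field
      isIdeal : IsIdeal M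
      proper  : ¬ M 1#
      maximal : ∀ (J : Sub) → IsIdeal J → M ⊆I J → (J ≐ M) ⊎ (J ≐ whole)

  prodPow : (k : ℕ) → (Fin k → Sub) → (Fin k → ℕ) → Sub
  prodPow zero M t = whole
  prodPow (sucℕ k) M t = (M fzero ^ t fzero) · prodPow k (λ i → M (fsuc i)) (λ i → t (fsuc i))

{-# OPTIONS --safe #-}
module Submission where

-- Maximal ideals are prime, so a maximal ideal containing one product contains, hence equals, one of
-- its factors: each Mᵢ is some Nⱼ and conversely, and distinctness makes this matching a bijection.
-- For the exponents, Mᵢ is comaximal with the other factors, which forces
-- Mᵢ ^ tᵢ ⊆ Mᵢ ^ (tᵢ + 1) + M₁ ^ t₁ ⋯ Mₖ ^ tₖ. If the product also lay in Mᵢ ^ (tᵢ + 1), then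
-- Mᵢ ^ tᵢ = Mᵢ ^ (tᵢ + 1), which the hypothesis forbids; so the product lies in no power of Mᵢ
-- above the tᵢ-th, and comparing the two factorisations gives sⱼ ≤ tᵢ and tᵢ ≤ sⱼ.

open import Defs
open import Level using (Level; lift; _⊔_)
open import Algebra.Bundles using (CommutativeRing)
open import Data.Nat using (ℕ; suc; _≤_)
import Data.Nat as ℕ
import Data.Nat.Properties as ℕ
open import Data.Fin using (Fin)
import Data.Fin as Fin
import Data.Fin.Properties as Fin
open import Data.Product using (_×_; Σ-syntax; _,_; proj₁; proj₂)
open import Data.Sum using (_⊎_; inj₁; inj₂)
open import Data.Empty using (⊥-elim)
open import Data.Unit using (tt)
open import Data.Maybe using (nothing)
open import Function.Bundles using (_↔_; Inverse; Injection; mk↔ₛ′)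
open import Function.Properties.Inverse using (↔⇒↣; ↔-sym)
open import Relation.Binary.PropositionalEquality using (_≡_; _≢_)
import Relation.Binary.PropositionalEquality as ≡
import Relation.Binary.Reasoning.Setoid as SetoidReasoning
open import Relation.Nullary using (¬_; yes; no)
open import Tactic.RingSolver.Core.AlmostCommutativeRing using (fromCommutativeRing)
import Tactic.RingSolver.NonReflective as RingSolver

Fin-↔⇒≡ : ∀ {m n} → Fin m ↔ Fin n → m ≡ n
Fin-↔⇒≡ σ = Fin.cantor-schröder-bernstein
  (Injection.injective (↔⇒↣ σ)) (Injection.injective (↔⇒↣ (↔-sym σ)))

module MaximalIdeals {c ℓ : Level} (R : CommutativeRing c ℓ) where
  open CommutativeRing R
  open IdealTheory R
  open RingSolver (fromCommutativeRing R (λ _ → nothing)) using (solve; _⊜_; _⊕_; _⊗_)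
  open SetoidReasoning setoid

  ⊆-refl : ∀ {I} → I ⊆I I
  ⊆-refl x p = p

  ⊆-trans : ∀ {I J K} → I ⊆I J → J ⊆I K → I ⊆I K
  ⊆-trans f g x p = g x (f x p)

  ≐-sym : ∀ {I J} → I ≐ J → J ≐ I
  ≐-sym (f , g) = g , f

  ≐-trans : ∀ {I J K} → I ≐ J → J ≐ K → I ≐ K
  ≐-trans (f , g) (f′ , g′) = ⊆-trans f f′ , ⊆-trans g′ g

  _+I_ : Sub → Sub → Sub
  (I +I J) x = Σ[ a ∈ Carrier ] Σ[ b ∈ Carrier ] I a × J b × (x ≈ a + b)

  Comaximal : Sub → Sub → Set (c ⊔ ℓ)
  Comaximal I J = (I +I J) 1#

  whole-isIdeal : IsIdeal whole
  whole-isIdeal = record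
    { resp = λ _ _ → lift tt ; zero∈ = lift tt ; +-closed = λ _ _ → lift tt ; *-closed = λ _ _ → lift tt }

  +I-isIdeal : ∀ {I J} → IsIdeal I → IsIdeal J → IsIdeal (I +I J)
  +I-isIdeal {I} {J} I-ideal J-ideal = record
    { resp = λ { x≈y (a , b , a∈I , b∈J , x≈a+b) → a , b , a∈I , b∈J , trans (sym x≈y) x≈a+b }
    ; zero∈ = 0# , 0# , I.zero∈ , J.zero∈ , sym (+-identityʳ 0#)
    ; +-closed = λ { (a , b , a∈I , b∈J , x≈a+b) (a′ , b′ , a′∈I , b′∈J , y≈a′+b′) →
        a + a′ , b + b′ , I.+-closed a∈I a′∈I , J.+-closed b∈J b′∈J ,
        trans (+-cong x≈a+b y≈a′+b′) (interchange a b a′ b′) }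
    ; *-closed = λ { r (a , b , a∈I , b∈J , x≈a+b) →
        r * a , r * b , I.*-closed r a∈I , J.*-closed r b∈J , trans (*-congˡ x≈a+b) (distribˡ r a b) }
    }
    where
    module I = IsIdeal I-ideal
    module J = IsIdeal J-ideal
    interchange : ∀ a b a′ b′ → (a + b) + (a′ + b′) ≈ (a + a′) + (b + b′)
    interchange = solve 4 (λ a b a′ b′ → ((a ⊕ b) ⊕ (a′ ⊕ b′)) ⊜ ((a ⊕ a′) ⊕ (b ⊕ b′))) refl

  ·-isIdeal : ∀ {I J} → IsIdeal I → IsIdeal J → IsIdeal (I · J)
  ·-isIdeal {I} {J} I-ideal J-ideal = record
    { resp = resp ; zero∈ = nil refl ; +-closed = λ p q → plus p q refl ; *-closed = *-closed }
    where
    resp : ∀ {x y} → x ≈ y → (I · J) x → (I · J) y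
    resp x≈y (gen a∈I b∈J x≈ab) = gen a∈I b∈J (trans (sym x≈y) x≈ab)
    resp x≈y (nil x≈0) = nil (trans (sym x≈y) x≈0)
    resp x≈y (plus p q x≈y+z) = plus p q (trans (sym x≈y) x≈y+z)
    *-closed : ∀ r {x} → (I · J) x → (I · J) (r * x)
    *-closed r (gen {a = a} {b} a∈I b∈J x≈ab) =
      gen (IsIdeal.*-closed I-ideal r a∈I) b∈J (trans (*-congˡ x≈ab) (sym (*-assoc r a b)))
    *-closed r (nil x≈0) = nil (trans (*-congˡ x≈0) (zeroʳ r))
    *-closed r (plus p q x≈y+z) = plus (*-closed r p) (*-closed r q) (trans (*-congˡ x≈y+z) (distribˡ r _ _))

  ^-isIdeal : ∀ {I} → IsIdeal I → ∀ n → IsIdeal (I ^ n)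
  ^-isIdeal I-ideal ℕ.zero = whole-isIdeal
  ^-isIdeal I-ideal (suc n) = ·-isIdeal (^-isIdeal I-ideal n) I-ideal

  prodPow-isIdeal : ∀ k (M : Fin k → Sub) t → (∀ i → IsIdeal (M i)) → IsIdeal (prodPow k M t)
  prodPow-isIdeal ℕ.zero M t M-ideal = whole-isIdeal
  prodPow-isIdeal (suc k) M t M-ideal =
    ·-isIdeal (^-isIdeal (M-ideal Fin.zero) (t Fin.zero)) (prodPow-isIdeal k _ _ (λ i → M-ideal (Fin.suc i)))

  ·-mono : ∀ {I I′ J J′} → I ⊆I I′ → J ⊆I J′ → (I · J) ⊆I (I′ · J′)
  ·-mono f g x (gen a∈I b∈J x≈ab) = gen (f _ a∈I) (g _ b∈J) x≈ab
  ·-mono f g x (nil x≈0) = nil x≈0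
  ·-mono f g x (plus p q x≈y+z) = plus (·-mono f g _ p) (·-mono f g _ q) x≈y+z

  ·-comm : ∀ {I J} → (I · J) ⊆I (J · I)
  ·-comm x (gen {a = a} {b} a∈I b∈J x≈ab) = gen b∈J a∈I (trans x≈ab (*-comm a b))
  ·-comm x (nil x≈0) = nil x≈0
  ·-comm x (plus p q x≈y+z) = plus (·-comm _ p) (·-comm _ q) x≈y+z

  ·-⊆ʳ : ∀ {I J} → IsIdeal J → (I · J) ⊆I J
  ·-⊆ʳ J-ideal x (gen {a = a} a∈I b∈J x≈ab) = resp (sym x≈ab) (*-closed a b∈J)
    where open IsIdeal J-ideal
  ·-⊆ʳ J-ideal x (nil x≈0) = resp (sym x≈0) zero∈
    where open IsIdeal J-ideal
  ·-⊆ʳ J-ideal x (plus p q x≈y+z) = resp (sym x≈y+z) (+-closed (·-⊆ʳ J-ideal _ p) (·-⊆ʳ J-ideal _ q))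
    where open IsIdeal J-ideal

  ·-⊆ˡ : ∀ {I J} → IsIdeal I → (I · J) ⊆I I
  ·-⊆ˡ I-ideal = ⊆-trans ·-comm (·-⊆ʳ I-ideal)

  ^-mono : ∀ {I J} → I ⊆I J → ∀ n → (I ^ n) ⊆I (J ^ n)
  ^-mono f ℕ.zero = ⊆-refl
  ^-mono f (suc n) = ·-mono (^-mono f n) f

  ^-antitone : ∀ {I} → IsIdeal I → ∀ {m n} → m ≤ n → (I ^ n) ⊆I (I ^ m)
  ^-antitone I-ideal m≤n = go (ℕ.≤⇒≤′ m≤n)
    where
    go : ∀ {m n} → m ℕ.≤′ n → (_ ^ n) ⊆I (_ ^ m)
    go ℕ.≤′-refl = ⊆-refl
    go (ℕ.≤′-step {n} m≤′n) = ⊆-trans (·-⊆ˡ (^-isIdeal I-ideal n)) (go m≤′n)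

  ^-⊆ : ∀ {I} → IsIdeal I → ∀ {n} → 1 ≤ n → (I ^ n) ⊆I I
  ^-⊆ I-ideal {suc n} _ = ·-⊆ʳ I-ideal

  prodPow-⊆-^ : ∀ k (M : Fin k → Sub) t → (∀ i → IsIdeal (M i)) → ∀ i → prodPow k M t ⊆I (M i ^ t i)
  prodPow-⊆-^ (suc k) M t M-ideal Fin.zero = ·-⊆ˡ (^-isIdeal (M-ideal Fin.zero) (t Fin.zero))
  prodPow-⊆-^ (suc k) M t M-ideal (Fin.suc i) =
    ⊆-trans (·-⊆ʳ (prodPow-isIdeal k _ _ (λ j → M-ideal (Fin.suc j))))
            (prodPow-⊆-^ k _ _ (λ j → M-ideal (Fin.suc j)) i)

  +I-monoʳ : ∀ {I J J′} → J ⊆I J′ → (I +I J) ⊆I (I +I J′)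
  +I-monoʳ f x (a , b , a∈I , b∈J , x≈a+b) = a , b , a∈I , f b b∈J , x≈a+b

  +I-⊆ : ∀ {I J K} → IsIdeal K → I ⊆I K → J ⊆I K → (I +I J) ⊆I K
  +I-⊆ K-ideal f g x (a , b , a∈I , b∈J , x≈a+b) = resp (sym x≈a+b) (+-closed (f a a∈I) (g b b∈J))
    where open IsIdeal K-ideal

  comaximal-whole : ∀ {M} → IsIdeal M → Comaximal M whole
  comaximal-whole M-ideal = 0# , 1# , IsIdeal.zero∈ M-ideal , lift tt , sym (+-identityˡ 1#)

  comaximal-· : ∀ {M I J} → IsIdeal M → Comaximal M I → Comaximal M J → Comaximal M (I · J)
  comaximal-· {M} M-ideal (m , a , m∈M , a∈I , 1≈m+a) (m′ , b , m′∈M , b∈J , 1≈m′+b) =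
    m * (m′ + b) + a * m′ , a * b ,
    +-closed (resp (*-comm (m′ + b) m) (*-closed (m′ + b) m∈M)) (*-closed a m′∈M) , gen a∈I b∈J refl ,
    (begin
      1#                                  ≈⟨ *-identityˡ 1# ⟨
      1# * 1#                             ≈⟨ *-cong 1≈m+a 1≈m′+b ⟩
      (m + a) * (m′ + b)                  ≈⟨ expand m a m′ b ⟩
      m * (m′ + b) + a * m′ + a * b       ∎)
    where
    open IsIdeal M-ideal
    expand : ∀ m a m′ b → (m + a) * (m′ + b) ≈ (m * (m′ + b) + a * m′) + a * b
    expand = solve 4 (λ m a m′ b → ((m ⊕ a) ⊗ (m′ ⊕ b)) ⊜ ((m ⊗ (m′ ⊕ b) ⊕ a ⊗ m′) ⊕ a ⊗ b)) refl

  comaximal-^ : ∀ {M I} → IsIdeal M → Comaximal M I → ∀ n → Comaximal M (I ^ n)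
  comaximal-^ M-ideal M+I∋1 ℕ.zero = comaximal-whole M-ideal
  comaximal-^ M-ideal M+I∋1 (suc n) = comaximal-· M-ideal (comaximal-^ M-ideal M+I∋1 n) M+I∋1

  comaximal-prodPow : ∀ {A} → IsIdeal A → ∀ k (M : Fin k → Sub) t →
                      (∀ i → Comaximal A (M i)) → Comaximal A (prodPow k M t)
  comaximal-prodPow A-ideal ℕ.zero M t A+M∋1 = comaximal-whole A-ideal
  comaximal-prodPow A-ideal (suc k) M t A+M∋1 =
    comaximal-· A-ideal (comaximal-^ A-ideal (A+M∋1 Fin.zero) (t Fin.zero))
                        (comaximal-prodPow A-ideal k _ _ (λ i → A+M∋1 (Fin.suc i)))

  ⊆⊎comaximal : ∀ {M I} → IsMaximal M → IsIdeal I → (I ⊆I M) ⊎ Comaximal M I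
  ⊆⊎comaximal {M} {I} M-max I-ideal with maximal (M +I I) (+I-isIdeal isIdeal I-ideal) M⊆M+I
    where
    open IsMaximal M-max
    M⊆M+I : M ⊆I (M +I I)
    M⊆M+I x x∈M = x , 0# , x∈M , IsIdeal.zero∈ I-ideal , sym (+-identityʳ x)
  ... | inj₁ (M+I⊆M , _) =
    inj₁ (λ x x∈I → M+I⊆M x (0# , x , IsIdeal.zero∈ (IsMaximal.isIdeal M-max) , x∈I , sym (+-identityˡ x)))
  ... | inj₂ (_ , whole⊆M+I) = inj₂ (whole⊆M+I 1# (lift tt))

  comaximal⇒⊈ : ∀ {M I} → IsMaximal M → Comaximal M I → ¬ (I ⊆I M)
  comaximal⇒⊈ M-max M+I∋1 I⊆M = proper (+I-⊆ isIdeal ⊆-refl I⊆M 1# M+I∋1)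
    where open IsMaximal M-max

  maximal⇒prime : ∀ {M I J} → IsMaximal M → IsIdeal I → IsIdeal J → (I · J) ⊆I M → (I ⊆I M) ⊎ (J ⊆I M)
  maximal⇒prime M-max I-ideal J-ideal IJ⊆M with ⊆⊎comaximal M-max I-ideal | ⊆⊎comaximal M-max J-ideal
  ... | inj₁ I⊆M | _ = inj₁ I⊆M
  ... | inj₂ _ | inj₁ J⊆M = inj₂ J⊆M
  ... | inj₂ M+I∋1 | inj₂ M+J∋1 =
    ⊥-elim (comaximal⇒⊈ M-max (comaximal-· (IsMaximal.isIdeal M-max) M+I∋1 M+J∋1) IJ⊆M)

  ^-⊆-maximal : ∀ {M I} → IsMaximal M → IsIdeal I → ∀ n → (I ^ n) ⊆I M → I ⊆I M
  ^-⊆-maximal M-max I-ideal ℕ.zero whole⊆M = ⊥-elim (IsMaximal.proper M-max (whole⊆M 1# (lift tt)))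
  ^-⊆-maximal M-max I-ideal (suc n) Iⁿ⁺¹⊆M with maximal⇒prime M-max (^-isIdeal I-ideal n) I-ideal Iⁿ⁺¹⊆M
  ... | inj₁ Iⁿ⊆M = ^-⊆-maximal M-max I-ideal n Iⁿ⊆M
  ... | inj₂ I⊆M = I⊆M

  maximal-⊆⇒≐ : ∀ {M N} → IsMaximal M → IsMaximal N → M ⊆I N → M ≐ N
  maximal-⊆⇒≐ M-max N-max M⊆N with IsMaximal.maximal M-max _ (IsMaximal.isIdeal N-max) M⊆N
  ... | inj₁ N≐M = ≐-sym N≐M
  ... | inj₂ (_ , whole⊆N) = ⊥-elim (IsMaximal.proper N-max (whole⊆N 1# (lift tt)))

  maximal-≐⊎comaximal : ∀ {M N} → IsMaximal M → IsMaximal N → (M ≐ N) ⊎ Comaximal M N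
  maximal-≐⊎comaximal M-max N-max with ⊆⊎comaximal M-max (IsMaximal.isIdeal N-max)
  ... | inj₁ N⊆M = inj₁ (≐-sym (maximal-⊆⇒≐ N-max M-max N⊆M))
  ... | inj₂ M+N∋1 = inj₂ M+N∋1

  distinct-maximal⇒comaximal : ∀ {k} {M : Fin k → Sub} → (∀ i → IsMaximal (M i)) →
                               (∀ i j → i ≢ j → ¬ (M i ≐ M j)) → ∀ i j → i ≢ j → Comaximal (M i) (M j)
  distinct-maximal⇒comaximal M-max M-distinct i j i≢j with maximal-≐⊎comaximal (M-max i) (M-max j)
  ... | inj₁ Mi≐Mj = ⊥-elim (M-distinct i j i≢j Mi≐Mj)
  ... | inj₂ Mi+Mj∋1 = Mi+Mj∋1

  prodPow-⊆-maximal : ∀ {N} → IsMaximal N → ∀ k (M : Fin k → Sub) t → (∀ i → IsMaximal (M i)) →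
                      prodPow k M t ⊆I N → Σ[ i ∈ Fin k ] M i ≐ N
  prodPow-⊆-maximal N-max ℕ.zero M t M-max whole⊆N = ⊥-elim (IsMaximal.proper N-max (whole⊆N 1# (lift tt)))
  prodPow-⊆-maximal N-max (suc k) M t M-max P⊆N
    with maximal⇒prime N-max (^-isIdeal (M-ideal Fin.zero) (t Fin.zero))
                             (prodPow-isIdeal k _ _ (λ i → M-ideal (Fin.suc i))) P⊆N
    where M-ideal = λ i → IsMaximal.isIdeal (M-max i)
  ... | inj₁ M₀^t₀⊆N =
    Fin.zero , maximal-⊆⇒≐ (M-max Fin.zero) N-max
                 (^-⊆-maximal N-max (IsMaximal.isIdeal (M-max Fin.zero)) (t Fin.zero) M₀^t₀⊆N)
  ... | inj₂ rest⊆N with prodPow-⊆-maximal N-max k _ _ (λ i → M-max (Fin.suc i)) rest⊆N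
  ...   | i , Mi≐N = Fin.suc i , Mi≐N

  -- I maps onto the layer M ^ n / M ^ suc n.
  Covers : Sub → ℕ → Sub → Set (c ⊔ ℓ)
  Covers M n I = (M ^ n) ⊆I ((M ^ suc n) +I I)

  covers-refl : ∀ {M} → IsIdeal M → ∀ n → Covers M n (M ^ n)
  covers-refl M-ideal n x x∈Mⁿ =
    0# , x , IsIdeal.zero∈ (^-isIdeal M-ideal (suc n)) , x∈Mⁿ , sym (+-identityˡ x)

  covers-mono : ∀ {M I J} n → I ⊆I J → Covers M n I → Covers M n J
  covers-mono n I⊆J covers = ⊆-trans covers (+I-monoʳ I⊆J)

  covers-·-comaximal : ∀ {M A I} → IsIdeal M → Comaximal M A → ∀ n → Covers M n I → Covers M n (I · A)
  covers-·-comaximal {M} M-ideal (m , a , m∈M , a∈A , 1≈m+a) n covers x x∈Mⁿ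
    with covers x x∈Mⁿ
  ... | y , z , y∈Mⁿ⁺¹ , z∈I , x≈y+z =
    x * m + y * a , z * a ,
    +-closed (gen x∈Mⁿ m∈M refl) (resp (*-comm a y) (*-closed a y∈Mⁿ⁺¹)) , gen z∈I a∈A refl ,
    (begin
      x                          ≈⟨ *-identityʳ x ⟨
      x * 1#                     ≈⟨ *-congˡ 1≈m+a ⟩
      x * (m + a)                ≈⟨ distribˡ x m a ⟩
      x * m + x * a              ≈⟨ +-congˡ (*-congʳ x≈y+z) ⟩
      x * m + (y + z) * a        ≈⟨ regroup (x * m) y z a ⟩
      x * m + y * a + z * a      ∎)
    where
    open IsIdeal (^-isIdeal M-ideal (suc n))
    regroup : ∀ p y z a → p + (y + z) * a ≈ (p + y * a) + z * a
    regroup = solve 4 (λ p y z a → (p ⊕ (y ⊕ z) ⊗ a) ⊜ ((p ⊕ y ⊗ a) ⊕ z ⊗ a)) refl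

  covers-prodPow : ∀ k (M : Fin k → Sub) t → (∀ i → IsIdeal (M i)) →
                   (∀ i j → i ≢ j → Comaximal (M i) (M j)) → ∀ i → Covers (M i) (t i) (prodPow k M t)
  covers-prodPow (suc k) M t M-ideal M-comaximal Fin.zero =
    covers-·-comaximal (M-ideal Fin.zero)
      (comaximal-prodPow (M-ideal Fin.zero) k _ _ (λ j → M-comaximal Fin.zero (Fin.suc j) (λ ())))
      (t Fin.zero) (covers-refl (M-ideal Fin.zero) (t Fin.zero))
  covers-prodPow (suc k) M t M-ideal M-comaximal (Fin.suc i) =
    covers-mono (t (Fin.suc i)) ·-comm
      (covers-·-comaximal (M-ideal (Fin.suc i))
        (comaximal-^ (M-ideal (Fin.suc i)) (M-comaximal (Fin.suc i) Fin.zero (λ ())) (t Fin.zero))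
        (t (Fin.suc i))
        (covers-prodPow k _ _ (λ j → M-ideal (Fin.suc j))
          (λ a b a≢b → M-comaximal (Fin.suc a) (Fin.suc b) (λ e → a≢b (Fin.suc-injective e))) i))

  covers-⊆-^suc⇒≐ : ∀ {M I} → IsIdeal M → ∀ n → Covers M n I → I ⊆I (M ^ suc n) → (M ^ n) ≐ (M ^ suc n)
  covers-⊆-^suc⇒≐ M-ideal n covers I⊆Mⁿ⁺¹ =
    ⊆-trans covers (+I-⊆ (^-isIdeal M-ideal (suc n)) ⊆-refl I⊆Mⁿ⁺¹) ,
    ·-⊆ˡ (^-isIdeal M-ideal n)

  prodPow-⊆-^⇒≤ : (∀ M → IsMaximal M → ∀ n → ¬ ((M ^ n) ≐ (M ^ suc n))) →
                  ∀ k (M : Fin k → Sub) t → (∀ i → IsMaximal (M i)) → (∀ i j → i ≢ j → ¬ (M i ≐ M j)) →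
                  ∀ i {u} → prodPow k M t ⊆I (M i ^ u) → u ≤ t i
  prodPow-⊆-^⇒≤ powers-distinct k M t M-max M-distinct i {u} P⊆Mᵢᵘ = ℕ.≮⇒≥ t<u-absurd
    where
    M-ideal = λ j → IsMaximal.isIdeal (M-max j)
    t<u-absurd : ¬ (t i ℕ.< u)
    t<u-absurd t<u = powers-distinct (M i) (M-max i) (t i)
      (covers-⊆-^suc⇒≐ (M-ideal i) (t i)
        (covers-prodPow k M t M-ideal (distinct-maximal⇒comaximal M-max M-distinct) i)
        (⊆-trans P⊆Mᵢᵘ (^-antitone (M-ideal i) t<u)))

  prodPow-⊆-factor : ∀ k (M : Fin k → Sub) t → (∀ i → IsIdeal (M i)) → (∀ i → 1 ≤ t i) →
                     ∀ i → prodPow k M t ⊆I M i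
  prodPow-⊆-factor k M t M-ideal t-pos i = ⊆-trans (prodPow-⊆-^ k M t M-ideal i) (^-⊆ (M-ideal i) (t-pos i))

  distinct-≐⇒≡ : ∀ {k} {M : Fin k → Sub} → (∀ i j → i ≢ j → ¬ (M i ≐ M j)) →
                 ∀ {i j} → M i ≐ M j → i ≡ j
  distinct-≐⇒≡ M-distinct {i} {j} Mi≐Mj with i Fin.≟ j
  ... | yes i≡j = i≡j
  ... | no i≢j = ⊥-elim (M-distinct i j i≢j Mi≐Mj)

  matching⇒↔ : ∀ {k r} {M : Fin k → Sub} {N : Fin r → Sub} →
               (∀ i j → i ≢ j → ¬ (M i ≐ M j)) → (∀ i j → i ≢ j → ¬ (N i ≐ N j)) →
               (∀ i → Σ[ j ∈ Fin r ] N j ≐ M i) → (∀ j → Σ[ i ∈ Fin k ] M i ≐ N j) →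
               Σ[ σ ∈ Fin k ↔ Fin r ] (∀ i → N (Inverse.to σ i) ≐ M i)
  matching⇒↔ {M = M} {N} M-distinct N-distinct match-M match-N =
    mk↔ₛ′ f g f∘g≗id g∘f≗id , λ i → proj₂ (match-M i)
    where
    f = λ i → proj₁ (match-M i)
    g = λ j → proj₁ (match-N j)
    f∘g≗id : ∀ j → f (g j) ≡ j
    f∘g≗id j = distinct-≐⇒≡ N-distinct (≐-trans (proj₂ (match-M (g j))) (proj₂ (match-N j)))
    g∘f≗id : ∀ i → g (f i) ≡ i
    g∘f≗id i = distinct-≐⇒≡ M-distinct (≐-trans (proj₂ (match-N (f i))) (proj₂ (match-M i)))

mainTheorem7 : ∀ {c ℓ : Level} (R : CommutativeRing c ℓ) → let open IdealTheory R in
    (∀ (M : Sub) → IsMaximal M → ∀ (i : ℕ) → ¬ ((M ^ i) ≐ (M ^ suc i))) →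
    (k r : ℕ) (M : Fin k → Sub) (t : Fin k → ℕ) (N : Fin r → Sub) (s : Fin r → ℕ) →
    (∀ i → IsMaximal (M i)) → (∀ i j → i ≢ j → ¬ (M i ≐ M j)) → (∀ i → 1 ≤ t i) →
    (∀ j → IsMaximal (N j)) → (∀ i j → i ≢ j → ¬ (N i ≐ N j)) → (∀ j → 1 ≤ s j) →
    prodPow k M t ≐ prodPow r N s →
    (r ≡ k) × (Σ[ σ ∈ Fin k ↔ Fin r ]
      (∀ i → (N (Inverse.to σ i) ≐ M i) × (s (Inverse.to σ i) ≡ t i)))
mainTheorem7 R powers-distinct k r M t N s M-max M-distinct t-pos N-max N-distinct s-pos (P⊆Q , Q⊆P) =
  ≡.sym (Fin-↔⇒≡ σ) , σ , λ i → Nσᵢ≐Mᵢ i , ℕ.≤-antisym (sσᵢ≤tᵢ i) (tᵢ≤sσᵢ i)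
  where
  open IdealTheory R
  open MaximalIdeals R
  M-ideal = λ i → IsMaximal.isIdeal (M-max i)
  N-ideal = λ j → IsMaximal.isIdeal (N-max j)
  matched = matching⇒↔ M-distinct N-distinct
    (λ i → prodPow-⊆-maximal (M-max i) r N s N-max (⊆-trans Q⊆P (prodPow-⊆-factor k M t M-ideal t-pos i)))
    (λ j → prodPow-⊆-maximal (N-max j) k M t M-max (⊆-trans P⊆Q (prodPow-⊆-factor r N s N-ideal s-pos j)))
  σ = proj₁ matched
  σᵢ = Inverse.to σ
  Nσᵢ≐Mᵢ = proj₂ matched
  sσᵢ≤tᵢ : ∀ i → s (σᵢ i) ≤ t i
  sσᵢ≤tᵢ i = prodPow-⊆-^⇒≤ powers-distinct k M t M-max M-distinct i
    (⊆-trans P⊆Q (⊆-trans (prodPow-⊆-^ r N s N-ideal (σᵢ i)) (^-mono (proj₁ (Nσᵢ≐Mᵢ i)) (s (σᵢ i)))))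
  tᵢ≤sσᵢ : ∀ i → t i ≤ s (σᵢ i)
  tᵢ≤sσᵢ i = prodPow-⊆-^⇒≤ powers-distinct r N s N-max N-distinct (σᵢ i)
    (⊆-trans Q⊆P (⊆-trans (prodPow-⊆-^ k M t M-ideal i) (^-mono (proj₂ (Nσᵢ≐Mᵢ i)) (t i))))
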